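{- Let $m$ and $n$ be positive integers divisible by $4$, and let $t\ge 2$ and $r\ge 1$ be integers. Then (i) $\gamma_{tR}(C_m\times C_n)=\frac{mn}{2}$; (ii) $\gamma_{tR}(C_m\times K_{t,t})=2m$; (iii) $\gamma_{tR}(C_m\times P_{C_{3r}})=2mr$; (iv) $\gamma_{tR}(K_{t,t}\times P_{C_{3r}})=8r$.
   Context: $C_k$ is the cycle on $k$ vertices. For a graph $G$, the prism $P_G$ is the Cartesian product $G\Box K_2$, i.e., two disjoint copies of $G$ together with a perfect matching joining each vertex to its copy. A function $f:V(G)\to\{0,1,2\}$ with $V_i=f^{ -1}(i)$ is a total Roman dominating function if every vertex in $V_0$ has a neighbor in $V_2$ and the subgraph induced by $V_1\cup V_2$ has no isolated vertices; $\gamma_{tR}(G)$ is the minimum of $\sum_v f(v)$ over such $f$. The direct product $G\times H$ has vertex set $V(G)\times V(H)$, with $(g,h)(g',h')$ an edge iff $gg'\in E(G)$ and $hh'\in E(H)$. -}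

module Defs where

open import Data.Nat using (ℕ; zero; suc; _+_; _*_; _≤_; _<_)
open import Data.Fin using (Fin; toℕ; splitAt; remQuot)
open import Data.Product using (Σ; _×_; _,_; ∃-syntax)
open import Data.Sum using (_⊎_; inj₁; inj₂)
open import Data.Empty using (⊥)
open import Relation.Binary.PropositionalEquality using (_≡_)
open import Relation.Nullary using (¬_)

record Graph : Set₁ where
  field
    order : ℕ
    adj   : Fin order → Fin order → Set
open Graph public

-- Cycle C_k on vertices 0..k-1: i ~ i+1 and k-1 ~ 0 (a simple cycle for k ≥ 3).
cycleAdj : (k : ℕ) → Fin k → Fin k → Set
cycleAdj k i j =
  (toℕ j ≡ suc (toℕ i)) ⊎ (toℕ i ≡ suc (toℕ j))
  ⊎ ((toℕ i ≡ 0 × suc (toℕ j) ≡ k) ⊎ (toℕ j ≡ 0 × suc (toℕ i) ≡ k))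

Cycle : ℕ → Graph
Cycle k = record { order = k ; adj = cycleAdj k }

-- Complete bipartite graph K_{t,t}: vertices 0..t-1 form one side, t..2t-1 the other.
kttAdj : (t : ℕ) → Fin (t + t) → Fin (t + t) → Set
kttAdj t i j = (toℕ i < t × t ≤ toℕ j) ⊎ (t ≤ toℕ i × toℕ j < t)

CompleteBipartite : ℕ → Graph
CompleteBipartite t = record { order = t + t ; adj = kttAdj t }

-- Prism P_G = G □ K_2: two copies of G (via splitAt) plus matching v ~ v'.
prismAdj : (G : Graph) → Fin (order G + order G) → Fin (order G + order G) → Set
prismAdj G i j with splitAt (order G) i | splitAt (order G) j
... | inj₁ a | inj₁ b = adj G a b
... | inj₂ a | inj₂ b = adj G a b
... | inj₁ a | inj₂ b = a ≡ b
... | inj₂ a | inj₁ b = a ≡ b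

Prism : Graph → Graph
Prism G = record { order = order G + order G ; adj = prismAdj G }

-- Direct (tensor) product G × H; vertex (g,h) encoded via remQuot.
directAdj : (G H : Graph) → Fin (order G * order H) → Fin (order G * order H) → Set
directAdj G H x y with remQuot (order H) x | remQuot (order H) y
... | (g , h) | (g' , h') = adj G g g' × adj H h h'

Direct : Graph → Graph → Graph
Direct G H = record { order = order G * order H ; adj = directAdj G H }

sumFin : (n : ℕ) → (Fin n → ℕ) → ℕ
sumFin zero    f = 0
sumFin (suc n) f = f Fin.zero + sumFin n (λ i → f (Fin.suc i))
  where import Data.Fin as Fin

-- Weight of f : V → {0,1,2} (values are natural numbers; labels constrained ≤ 2).
weight : (G : Graph) → (Fin (order G) → ℕ) → ℕ
weight G f = sumFin (order G) f

IsTRDF : (G : Graph) → (Fin (order G) → ℕ) → Set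
IsTRDF G f =
  ((v : Fin (order G)) → f v ≤ 2)
  × ((v : Fin (order G)) → f v ≡ 0 → ∃[ u ] (adj G v u × f u ≡ 2))
  × ((v : Fin (order G)) → ¬ (f v ≡ 0) → ∃[ u ] (adj G v u × ¬ (f u ≡ 0)))

TRDomNumberIs : Graph → ℕ → Set
TRDomNumberIs G k =
  (∃[ f ] (IsTRDF G f × weight G f ≡ k))
  × ((f : Fin (order G) → ℕ) → IsTRDF G f → k ≤ weight G f)

module Submission where

open import Defs
open import Data.Nat using (ℕ; _*_; _≤_; _<_)
open import Data.Nat.DivMod using (_/_)
open import Data.Nat.Divisibility using (_∣_)
open import Data.Product using (_×_)

open import Data.Nat using (zero; suc; _+_; z≤n; s≤s; NonZero; >-nonZero; >-nonZero⁻¹)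
open import Data.Nat.Properties
open import Data.Nat.DivMod using (_%_; m≡m%n+[m/n]*n; [m+kn]%n≡m%n; [m+n]%n≡m%n; m<n⇒m%n≡m;
  m≤n⇒m%n≡m; n%n≡0; m%n<n; %-remove-+ˡ; m<[1+n%d]⇒m≤[n%d]; [1+m%d]≤1+n⇒[m%d]≤n; m*n/n≡m)
open import Data.Nat.Divisibility using (divides; n∣m⇒m%n≡0; n∣m*n)
open import Data.Nat.Tactic.RingSolver using (solve-∀)
open import Data.Bool using (true; false; if_then_else_)
open import Data.Fin using (Fin; toℕ; fromℕ<; _↑ˡ_; _↑ʳ_; splitAt; join; combine; quotient; remainder; remQuot)
import Data.Fin as Fin
import Data.Fin.Properties as Fin
open import Data.Product using (_,_; proj₁; proj₂; ∃-syntax)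
open import Data.Sum using (_⊎_; inj₁; inj₂; reduce)
open import Data.Empty using (⊥-elim)
open import Function using (id)
open import Relation.Nullary using (¬_; Dec; yes; no; does)
open import Relation.Nullary.Decidable using (_×-dec_; _⊎-dec_; map′; dec-true; dec-false)
open import Relation.Binary.PropositionalEquality
open import Algebra.Properties.CommutativeMonoid.Sum +-0-commutativeMonoid
  using (sum-syntax; sum-cong-≗; sum-replicate-zero; ∑-distrib-+; ∑-comm)
open import Algebra.Properties.Semiring.Sum +-*-semiring using (*-distribˡ-sum; *-distribʳ-sum)

-- The four values all come from one general theorem (direct-product-γtR):
-- if G and H have maximum degrees Δ, Δ' with ΔΔ' ≥ 2 and *perfect* total
-- dominating sets A, B (Δ|A| = |V(G)|, Δ'|B| = |V(H)|), then
-- γ_tR(G × H) = 2|A||B|.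
--   * Upper bound: labelling A × B with 2 and everything else with 0 is a total
--     Roman dominating function of G × H (product-trdf).
--   * Lower bound: in any graph of maximum degree Δ ≥ 2, a TRDF f satisfies
--     2|V| ≤ Δ·w(f) (trdf-lower-bound), by double counting the edges between
--     V₀ and V₂; the maximum degree of G × H is at most ΔΔ' (direct-degree), and
--     2|V(G × H)| = ΔΔ'·2|A||B| by perfectness.

sumFin≡∑ : ∀ n (f : Fin n → ℕ) → sumFin n f ≡ ∑[ i < n ] f i
sumFin≡∑ zero    f = refl
sumFin≡∑ (suc n) f = cong (f Fin.zero +_) (sumFin≡∑ n (λ i → f (Fin.suc i)))

∑-mono : ∀ n {f g : Fin n → ℕ} → (∀ i → f i ≤ g i) → ∑[ i < n ] f i ≤ ∑[ i < n ] g i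
∑-mono zero    f≤g = z≤n
∑-mono (suc n) f≤g = +-mono-≤ (f≤g Fin.zero) (∑-mono n (λ i → f≤g (Fin.suc i)))

∑-mono-< : ∀ n {f g : Fin n → ℕ} → (∀ i → f i ≤ g i) → (v : Fin n) → f v < g v →
  ∑[ i < n ] f i < ∑[ i < n ] g i
∑-mono-< (suc n) f≤g Fin.zero    fv<gv = +-mono-<-≤ fv<gv (∑-mono n (λ i → f≤g (Fin.suc i)))
∑-mono-< (suc n) f≤g (Fin.suc v) fv<gv =
  +-mono-≤-< (f≤g Fin.zero) (∑-mono-< n (λ i → f≤g (Fin.suc i)) v fv<gv)

term≤∑ : ∀ n (f : Fin n → ℕ) (v : Fin n) → f v ≤ ∑[ i < n ] f i
term≤∑ (suc n) f Fin.zero    = m≤m+n _ _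
term≤∑ (suc n) f (Fin.suc v) = ≤-trans (term≤∑ n (λ i → f (Fin.suc i)) v) (m≤n+m _ _)

∑-const : ∀ n c → ∑[ i < n ] c ≡ n * c
∑-const zero    c = refl
∑-const (suc n) c = cong (c +_) (∑-const n c)

∑-++ : ∀ m n (f : Fin (m + n) → ℕ) →
  ∑[ i < m + n ] f i ≡ ∑[ i < m ] f (i ↑ˡ n) + ∑[ j < n ] f (m ↑ʳ j)
∑-++ zero    n f = refl
∑-++ (suc m) n f =
  trans (cong (f Fin.zero +_) (∑-++ m n (λ i → f (Fin.suc i)))) (sym (+-assoc (f Fin.zero) _ _))

∑-splitAt : ∀ m n (g : Fin m ⊎ Fin n → ℕ) →
  ∑[ u < m + n ] g (splitAt m u) ≡ ∑[ a < m ] g (inj₁ a) + ∑[ b < n ] g (inj₂ b)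
∑-splitAt m n g = trans (∑-++ m n (λ u → g (splitAt m u)))
  (cong₂ _+_ (sum-cong-≗ (λ a → cong g (Fin.splitAt-↑ˡ m a n)))
             (sum-cong-≗ (λ b → cong g (Fin.splitAt-↑ʳ m n b))))

∑-combine : ∀ m n (f : Fin (m * n) → ℕ) →
  ∑[ x < m * n ] f x ≡ ∑[ i < m ] ∑[ j < n ] f (combine i j)
∑-combine zero    n f = refl
∑-combine (suc m) n f =
  trans (∑-++ n (m * n) f) (cong (∑[ j < n ] f (j ↑ˡ (m * n)) +_) (∑-combine m n (λ x → f (n ↑ʳ x))))

-- 0/1 indicators of decidable propositions.  Defined through 'does', so that
-- indicators of concrete comparisons of naturals compute.

𝟙 : ∀ {P : Set} → Dec P → ℕ
𝟙 d = if does d then 1 else 0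

𝟙≤1 : ∀ {P : Set} (d : Dec P) → 𝟙 d ≤ 1
𝟙≤1 d with does d
... | true  = ≤-refl
... | false = z≤n

𝟙-yes : ∀ {P : Set} (d : Dec P) → P → 𝟙 d ≡ 1
𝟙-yes d p = cong (λ b → if b then 1 else 0) (dec-true d p)

𝟙-no : ∀ {P : Set} (d : Dec P) → ¬ P → 𝟙 d ≡ 0
𝟙-no d ¬p = cong (λ b → if b then 1 else 0) (dec-false d ¬p)

𝟙-cong : ∀ {P Q : Set} → (P → Q) → (Q → P) → (d : Dec P) (e : Dec Q) → 𝟙 d ≡ 𝟙 e
𝟙-cong p→q q→p (yes p) e = sym (𝟙-yes e (p→q p))
𝟙-cong p→q q→p (no ¬p) e = sym (𝟙-no e (λ q → ¬p (q→p q)))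

𝟙-→ : ∀ {P Q : Set} → (P → Q) → (d : Dec P) (e : Dec Q) → 𝟙 d ≤ 𝟙 e
𝟙-→ p→q (yes p) e = ≤-reflexive (sym (𝟙-yes e (p→q p)))
𝟙-→ p→q (no _)  e = z≤n

𝟙-⊎ : ∀ {P Q R : Set} → (P → Q ⊎ R) → (d : Dec P) (e : Dec Q) (g : Dec R) → 𝟙 d ≤ 𝟙 e + 𝟙 g
𝟙-⊎ p→q⊎r (no _)  e g = z≤n
𝟙-⊎ p→q⊎r (yes p) e g with p→q⊎r p
... | inj₁ q = ≤-trans (≤-reflexive (sym (𝟙-yes e q))) (m≤m+n _ _)
... | inj₂ r = ≤-trans (≤-reflexive (sym (𝟙-yes g r))) (m≤n+m _ _)

𝟙-× : ∀ {P Q : Set} (d : Dec P) (e : Dec Q) → 𝟙 (d ×-dec e) ≡ 𝟙 d * 𝟙 e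
𝟙-× (yes _) e = sym (+-identityʳ (𝟙 e))
𝟙-× (no _)  e = refl

count-index : ∀ n s → ∑[ j < n ] 𝟙 (toℕ j ≟ s) ≡ 𝟙 (s <? n)
count-index zero    s       = refl
count-index (suc n) zero    = cong suc (sum-replicate-zero n)
count-index (suc n) (suc s) = count-index n s

count-below : ∀ a b → ∑[ j < a + b ] 𝟙 (toℕ j <? a) ≡ a
count-below zero    b = sum-replicate-zero b
count-below (suc a) b = cong suc (count-below a b)

count-from : ∀ a b → ∑[ j < a + b ] 𝟙 (a ≤? toℕ j) ≡ b
count-from zero    b = trans (∑-const b 1) (*-identityʳ b)
count-from (suc a) b =
  trans (sum-cong-≗ {a + b} (λ j → 𝟙-cong ≤-pred s≤s (suc a ≤? suc (toℕ j)) (a ≤? toℕ j))) (count-from a b)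

-- Transport along an equation between types (the adjacency relations of Prism
-- and Direct are defined by 'with', and are converted through such equations).
cast : ∀ {A B : Set} → A ≡ B → A → B
cast = subst id

record MaxDegree (G : Graph) (Δ : ℕ) : Set where
  field
    adj?    : ∀ v u → Dec (adj G v u)
    adj-sym : ∀ {v u} → adj G v u → adj G u v
    degree≤ : ∀ v → ∑[ u < order G ] 𝟙 (adj? v u) ≤ Δ

double-count : ∀ n (A : Fin n → Fin n → ℕ) → (∀ v u → A v u ≡ A u v) → (x y : Fin n → ℕ) →
  ∑[ v < n ] ∑[ u < n ] (x v * (A v u * y u)) ≡ ∑[ u < n ] (y u * ∑[ v < n ] (A u v * x v))
double-count n A A-sym x y = begin
    ∑[ v < n ] ∑[ u < n ] (x v * (A v u * y u))
  ≡⟨ ∑-comm (λ v u → x v * (A v u * y u)) ⟩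
    ∑[ u < n ] ∑[ v < n ] (x v * (A v u * y u))
  ≡⟨ sum-cong-≗ (λ u → sum-cong-≗ (λ v → reorder u v)) ⟩
    ∑[ u < n ] ∑[ v < n ] (y u * (A u v * x v))
  ≡⟨ sum-cong-≗ (λ u → sym (*-distribˡ-sum (y u) (λ v → A u v * x v))) ⟩
    ∑[ u < n ] (y u * ∑[ v < n ] (A u v * x v))
  ∎
  where
  open ≡-Reasoning
  reorder : ∀ u v → x v * (A v u * y u) ≡ y u * (A u v * x v)
  reorder u v rewrite A-sym v u = swap-ends (x v) (A u v) (y u)
    where swap-ends : ∀ a b c → a * (b * c) ≡ c * (b * a)
          swap-ends = solve-∀

-- With Z, O, T the sizes of V₀, V₁, V₂:
-- each vertex of V₀ has a neighbour in V₂, while each vertex of V₂ has at most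
-- Δ - 1 neighbours in V₀, so Z ≤ (Δ - 1)T; hence 2|V| = 2(Z + T) + 2O ≤ Δ(2T + O).
module _ {G : Graph} {Δ : ℕ} (md : MaxDegree G Δ) (2≤Δ : 2 ≤ Δ)
         (f : Fin (order G) → ℕ) (trdf : IsTRDF G f) where
  open MaxDegree md

  private
    N = order G
    A : Fin N → Fin N → ℕ
    A v u = 𝟙 (adj? v u)

    z o t : Fin N → ℕ
    z v = 𝟙 (f v ≟ 0)
    o v = 𝟙 (f v ≟ 1)
    t v = 𝟙 (f v ≟ 2)

    Z O T : ℕ
    Z = ∑[ v < N ] z v
    O = ∑[ v < N ] o v
    T = ∑[ v < N ] t v

    A-sym : ∀ v u → A v u ≡ A u v
    A-sym v u = 𝟙-cong adj-sym adj-sym (adj? v u) (adj? u v)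

    label-classes : ∀ v → z v + o v + t v ≡ 1 × f v ≡ o v + 2 * t v
    label-classes v with f v | proj₁ trdf v
    ... | 0 | _ = refl , refl
    ... | 1 | _ = refl , refl
    ... | 2 | _ = refl , refl
    ... | suc (suc (suc _)) | s≤s (s≤s ())

    zero-sees-two : ∀ v → z v ≤ ∑[ u < N ] (z v * (A v u * t u))
    zero-sees-two v with f v in fv
    ... | suc _ = z≤n
    ... | 0 with proj₁ (proj₂ trdf) v fv
    ...   | u , v~u , fu≡2 = ≤-trans (≤-reflexive (sym term≡1)) (term≤∑ N _ u)
      where
      term≡1 : 1 * (A v u * t u) ≡ 1
      term≡1 rewrite 𝟙-yes (adj? v u) v~u | 𝟙-yes (f u ≟ 2) fu≡2 = refl

    -- a vertex labelled 2 has a neighbour with non-zero label, hence at most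
    -- Δ - 1 neighbours labelled 0
    two-sees-nonzero : ∀ u → t u * ∑[ v < N ] (A u v * z v) + t u ≤ t u * Δ
    two-sees-nonzero u with f u in fu≡2
    ... | 0 = z≤n
    ... | 1 = z≤n
    ... | suc (suc (suc _)) = z≤n
    ... | 2 with proj₂ (proj₂ trdf) u (λ fu≡0 → 2≢0 (trans (sym fu≡2) fu≡0))
      where 2≢0 : ¬ (2 ≡ 0)
            2≢0 ()
    ...   | v₀ , u~v₀ , fv₀≢0 rewrite *-identityˡ (∑[ v < N ] (A u v * z v)) | *-identityˡ Δ =
      subst (_≤ Δ) (+-comm 1 _) (≤-trans (∑-mono-< N below-A v₀ strict-at-v₀) (degree≤ u))
      where
      below-A : ∀ v → A u v * z v ≤ A u v
      below-A v = ≤-trans (*-monoʳ-≤ (A u v) (𝟙≤1 (f v ≟ 0))) (≤-reflexive (*-identityʳ _))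
      strict-at-v₀ : A u v₀ * z v₀ < A u v₀
      strict-at-v₀ rewrite 𝟙-yes (adj? u v₀) u~v₀ | 𝟙-no (f v₀ ≟ 0) fv₀≢0 = s≤s z≤n

    Z+T≤ΔT : Z + T ≤ Δ * T
    Z+T≤ΔT = begin
        Z + T
      ≤⟨ +-monoˡ-≤ T (∑-mono N zero-sees-two) ⟩
        ∑[ v < N ] ∑[ u < N ] (z v * (A v u * t u)) + T
      ≡⟨ cong (_+ T) (double-count N A A-sym z t) ⟩
        ∑[ u < N ] (t u * ∑[ v < N ] (A u v * z v)) + T
      ≡⟨ sym (∑-distrib-+ (λ u → t u * ∑[ v < N ] (A u v * z v)) t) ⟩
        ∑[ u < N ] (t u * ∑[ v < N ] (A u v * z v) + t u)
      ≤⟨ ∑-mono N two-sees-nonzero ⟩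
        ∑[ u < N ] (t u * Δ)
      ≡⟨ sum-cong-≗ (λ u → *-comm (t u) Δ) ⟩
        ∑[ u < N ] (Δ * t u)
      ≡⟨ sym (*-distribˡ-sum Δ t) ⟩
        Δ * T
      ∎
      where open ≤-Reasoning

    N≡Z+O+T : N ≡ Z + O + T
    N≡Z+O+T = begin
        N                                  ≡⟨ sym (trans (∑-const N 1) (*-identityʳ N)) ⟩
        ∑[ v < N ] 1                       ≡⟨ sum-cong-≗ (λ v → sym (proj₁ (label-classes v))) ⟩
        ∑[ v < N ] (z v + o v + t v)       ≡⟨ ∑-distrib-+ (λ v → z v + o v) t ⟩
        ∑[ v < N ] (z v + o v) + T         ≡⟨ cong (_+ T) (∑-distrib-+ z o) ⟩
        Z + O + T                          ∎
      where open ≡-Reasoning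

    W≡O+2T : weight G f ≡ O + 2 * T
    W≡O+2T = begin
        weight G f                         ≡⟨ sumFin≡∑ N f ⟩
        ∑[ v < N ] f v                     ≡⟨ sum-cong-≗ (λ v → proj₂ (label-classes v)) ⟩
        ∑[ v < N ] (o v + 2 * t v)         ≡⟨ ∑-distrib-+ o (λ v → 2 * t v) ⟩
        O + ∑[ v < N ] (2 * t v)           ≡⟨ cong (O +_) (sym (*-distribˡ-sum 2 t)) ⟩
        O + 2 * T                          ∎
      where open ≡-Reasoning

  trdf-lower-bound : 2 * order G ≤ Δ * weight G f
  trdf-lower-bound = begin
      2 * N                  ≡⟨ cong (2 *_) N≡Z+O+T ⟩
      2 * (Z + O + T)        ≡⟨ regroup Z O T ⟩
      2 * (Z + T) + 2 * O    ≤⟨ +-mono-≤ (*-monoʳ-≤ 2 Z+T≤ΔT) (*-monoˡ-≤ O 2≤Δ) ⟩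
      2 * (Δ * T) + Δ * O    ≡⟨ factor Δ T O ⟩
      Δ * (O + 2 * T)        ≡⟨ cong (Δ *_) (sym W≡O+2T) ⟩
      Δ * weight G f         ∎
    where
    open ≤-Reasoning
    regroup : ∀ a b c → 2 * (a + b + c) ≡ 2 * (a + c) + 2 * b
    regroup = solve-∀
    factor : ∀ d a b → 2 * (d * a) + d * b ≡ d * (b + 2 * a)
    factor = solve-∀

two-candidates : ∀ {n} {P : Fin n → Set} (P? : ∀ u → Dec (P u)) (s₁ s₂ : ℕ) →
  (∀ u → P u → toℕ u ≡ s₁ ⊎ toℕ u ≡ s₂) → ∑[ u < n ] 𝟙 (P? u) ≤ 2
two-candidates {n} P? s₁ s₂ cand = begin
    ∑[ u < n ] 𝟙 (P? u)
  ≤⟨ ∑-mono n (λ u → 𝟙-⊎ (cand u) (P? u) (toℕ u ≟ s₁) (toℕ u ≟ s₂)) ⟩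
    ∑[ u < n ] (𝟙 (toℕ u ≟ s₁) + 𝟙 (toℕ u ≟ s₂))
  ≡⟨ ∑-distrib-+ {n} (λ u → 𝟙 (toℕ u ≟ s₁)) (λ u → 𝟙 (toℕ u ≟ s₂)) ⟩
    ∑[ u < n ] 𝟙 (toℕ u ≟ s₁) + ∑[ u < n ] 𝟙 (toℕ u ≟ s₂)
  ≤⟨ +-mono-≤ (at-most-one s₁) (at-most-one s₂) ⟩
    2
  ∎
  where
  open ≤-Reasoning
  at-most-one : ∀ s → ∑[ u < n ] 𝟙 (toℕ u ≟ s) ≤ 1
  at-most-one s = ≤-trans (≤-reflexive (count-index n s)) (𝟙≤1 (s <? n))

cycle-neighbours : ∀ {n} (i j : Fin (suc n)) → cycleAdj (suc n) i j →
  toℕ j ≡ suc (toℕ i) % suc n ⊎ toℕ j ≡ (toℕ i + n) % suc n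
cycle-neighbours {n} i j (inj₁ j≡1+i) =
  inj₁ (trans j≡1+i (sym (m<n⇒m%n≡m (subst (_< suc n) j≡1+i (Fin.toℕ<n j)))))
cycle-neighbours {n} i j (inj₂ (inj₁ i≡1+j)) = inj₂ (begin
    toℕ j                     ≡⟨ sym (m<n⇒m%n≡m (Fin.toℕ<n j)) ⟩
    toℕ j % suc n             ≡⟨ sym ([m+n]%n≡m%n (toℕ j) (suc n)) ⟩
    (toℕ j + suc n) % suc n   ≡⟨ cong (_% suc n) (+-suc (toℕ j) n) ⟩
    (suc (toℕ j) + n) % suc n ≡⟨ cong (λ x → (x + n) % suc n) (sym i≡1+j) ⟩
    (toℕ i + n) % suc n       ∎)
  where open ≡-Reasoning
cycle-neighbours {n} i j (inj₂ (inj₂ (inj₁ (i≡0 , 1+j≡k)))) rewrite i≡0 =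
  inj₂ (trans (suc-injective 1+j≡k) (sym (m≤n⇒m%n≡m ≤-refl)))
cycle-neighbours {n} i j (inj₂ (inj₂ (inj₂ (j≡0 , 1+i≡k)))) rewrite 1+i≡k =
  inj₁ (trans j≡0 (sym (n%n≡0 (suc n))))

cycle-adj? : ∀ k (i j : Fin k) → Dec (cycleAdj k i j)
cycle-adj? k i j = (toℕ j ≟ suc (toℕ i)) ⊎-dec (toℕ i ≟ suc (toℕ j))
  ⊎-dec (((toℕ i ≟ 0) ×-dec (suc (toℕ j) ≟ k)) ⊎-dec ((toℕ j ≟ 0) ×-dec (suc (toℕ i) ≟ k)))

cycle-sym : ∀ {k} {i j : Fin k} → cycleAdj k i j → cycleAdj k j i
cycle-sym (inj₁ e)               = inj₂ (inj₁ e)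
cycle-sym (inj₂ (inj₁ e))        = inj₁ e
cycle-sym (inj₂ (inj₂ (inj₁ e))) = inj₂ (inj₂ (inj₂ e))
cycle-sym (inj₂ (inj₂ (inj₂ e))) = inj₂ (inj₂ (inj₁ e))

cycle-degree : ∀ k → MaxDegree (Cycle k) 2
cycle-degree k = record { adj? = cycle-adj? k ; adj-sym = cycle-sym ; degree≤ = degree≤ }
  where
  degree≤ : ∀ {k} (i : Fin k) → ∑[ j < k ] 𝟙 (cycle-adj? k i j) ≤ 2
  degree≤ {suc n} i = two-candidates (cycle-adj? (suc n) i) _ _ (cycle-neighbours i)

ktt-adj? : ∀ t (i j : Fin (t + t)) → Dec (kttAdj t i j)
ktt-adj? t i j = ((toℕ i <? t) ×-dec (t ≤? toℕ j)) ⊎-dec ((t ≤? toℕ i) ×-dec (toℕ j <? t))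

ktt-sym : ∀ {t} {i j : Fin (t + t)} → kttAdj t i j → kttAdj t j i
ktt-sym (inj₁ (i<t , t≤j)) = inj₂ (t≤j , i<t)
ktt-sym (inj₂ (t≤i , j<t)) = inj₁ (j<t , t≤i)

ktt-degree : ∀ t → MaxDegree (CompleteBipartite t) t
ktt-degree t = record { adj? = ktt-adj? t ; adj-sym = ktt-sym ; degree≤ = degree≤ }
  where
  degree≤ : ∀ i → ∑[ j < t + t ] 𝟙 (ktt-adj? t i j) ≤ t
  degree≤ i with toℕ i <? t
  ... | yes i<t = ≤-trans (∑-mono (t + t) (λ j → 𝟙-→ right-side (ktt-adj? t i j) (t ≤? toℕ j)))
                          (≤-reflexive (count-from t t))
    where
    right-side : ∀ {j} → kttAdj t i j → t ≤ toℕ j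
    right-side (inj₁ (_ , t≤j)) = t≤j
    right-side (inj₂ (t≤i , _)) = ⊥-elim (<⇒≱ i<t t≤i)
  ... | no i≮t = ≤-trans (∑-mono (t + t) (λ j → 𝟙-→ left-side (ktt-adj? t i j) (toℕ j <? t)))
                         (≤-reflexive (count-below t t))
    where
    left-side : ∀ {j} → kttAdj t i j → toℕ j < t
    left-side (inj₁ (i<t , _)) = ⊥-elim (i≮t i<t)
    left-side (inj₂ (_ , j<t)) = j<t

PrismAdj : (G : Graph) → Fin (order G) ⊎ Fin (order G) → Fin (order G) ⊎ Fin (order G) → Set
PrismAdj G (inj₁ a) (inj₁ b) = adj G a b
PrismAdj G (inj₂ a) (inj₂ b) = adj G a b
PrismAdj G (inj₁ a) (inj₂ b) = a ≡ b
PrismAdj G (inj₂ a) (inj₁ b) = a ≡ b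

prism-view : ∀ G v u → prismAdj G v u ≡ PrismAdj G (splitAt (order G) v) (splitAt (order G) u)
prism-view G v u with splitAt (order G) v | splitAt (order G) u
... | inj₁ a | inj₁ b = refl
... | inj₂ a | inj₂ b = refl
... | inj₁ a | inj₂ b = refl
... | inj₂ a | inj₁ b = refl

prism-adj-join : ∀ G v s → PrismAdj G (splitAt (order G) v) s →
  prismAdj G v (join (order G) (order G) s)
prism-adj-join G v s v~s = cast (sym (prism-view G v (join n n s)))
  (subst (PrismAdj G (splitAt n v)) (sym (Fin.splitAt-join n n s)) v~s)
  where n = order G

prism-degree : ∀ {G Δ} → MaxDegree G Δ → MaxDegree (Prism G) (Δ + 1)
prism-degree {G} {Δ} md = record { adj? = prism-adj? ; adj-sym = prism-sym ; degree≤ = degree≤ }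
  where
  module G = MaxDegree md
  n = order G

  tagged? : ∀ s s' → Dec (PrismAdj G s s')
  tagged? (inj₁ a) (inj₁ b) = G.adj? a b
  tagged? (inj₂ a) (inj₂ b) = G.adj? a b
  tagged? (inj₁ a) (inj₂ b) = a Fin.≟ b
  tagged? (inj₂ a) (inj₁ b) = a Fin.≟ b

  tagged-sym : ∀ s s' → PrismAdj G s s' → PrismAdj G s' s
  tagged-sym (inj₁ a) (inj₁ b) = G.adj-sym
  tagged-sym (inj₂ a) (inj₂ b) = G.adj-sym
  tagged-sym (inj₁ a) (inj₂ b) = sym
  tagged-sym (inj₂ a) (inj₁ b) = sym

  prism-adj? : ∀ v u → Dec (prismAdj G v u)
  prism-adj? v u = map′ (cast (sym (prism-view G v u))) (cast (prism-view G v u))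
                        (tagged? (splitAt n v) (splitAt n u))

  prism-sym : ∀ {v u} → prismAdj G v u → prismAdj G u v
  prism-sym {v} {u} v~u = cast (sym (prism-view G u v))
    (tagged-sym (splitAt n v) (splitAt n u) (cast (prism-view G v u) v~u))

  copy-count : ∀ a → ∑[ b < n ] 𝟙 (a Fin.≟ b) ≤ 1
  copy-count a = begin
      ∑[ b < n ] 𝟙 (a Fin.≟ b)
    ≡⟨ sum-cong-≗ (λ b → 𝟙-cong (λ a≡b → cong toℕ (sym a≡b)) (λ b≡a → sym (Fin.toℕ-injective b≡a))
                                (a Fin.≟ b) (toℕ b ≟ toℕ a)) ⟩
      ∑[ b < n ] 𝟙 (toℕ b ≟ toℕ a)
    ≡⟨ count-index n (toℕ a) ⟩
      𝟙 (toℕ a <? n)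
    ≤⟨ 𝟙≤1 (toℕ a <? n) ⟩
      1
    ∎
    where open ≤-Reasoning

  tagged-degree : ∀ s → ∑[ b < n ] 𝟙 (tagged? s (inj₁ b)) + ∑[ b < n ] 𝟙 (tagged? s (inj₂ b)) ≤ Δ + 1
  tagged-degree (inj₁ a) = +-mono-≤ (G.degree≤ a) (copy-count a)
  tagged-degree (inj₂ a) = subst (_≤ Δ + 1) (+-comm _ (∑[ b < n ] 𝟙 (a Fin.≟ b)))
                                 (+-mono-≤ (G.degree≤ a) (copy-count a))

  degree≤ : ∀ v → ∑[ u < n + n ] 𝟙 (prism-adj? v u) ≤ Δ + 1
  degree≤ v = ≤-trans (≤-reflexive (∑-splitAt n n (λ s' → 𝟙 (tagged? (splitAt n v) s'))))
                      (tagged-degree (splitAt n v))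

direct-view : ∀ G H x y → directAdj G H x y ≡
  (adj G (quotient {order G} (order H) x) (quotient (order H) y)
   × adj H (remainder {order G} (order H) x) (remainder {order G} (order H) y))
direct-view G H x y with remQuot {order G} (order H) x | remQuot {order G} (order H) y
... | (g , h) | (g' , h') = refl

direct-degree : ∀ {G H Δ Δ'} → MaxDegree G Δ → MaxDegree H Δ' → MaxDegree (Direct G H) (Δ * Δ')
direct-degree {G} {H} {Δ} {Δ'} mdG mdH =
  record { adj? = direct-adj? ; adj-sym = direct-sym ; degree≤ = degree≤ }
  where
  module G = MaxDegree mdG
  module H = MaxDegree mdH
  p = order G
  q = order H
  π₁ : Fin (p * q) → Fin p
  π₁ = quotient {p} q
  π₂ : Fin (p * q) → Fin q
  π₂ = remainder {p} q

  direct-adj? : ∀ x y → Dec (directAdj G H x y)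
  direct-adj? x y = map′ (cast (sym (direct-view G H x y))) (cast (direct-view G H x y))
                         (G.adj? (π₁ x) (π₁ y) ×-dec H.adj? (π₂ x) (π₂ y))

  direct-sym : ∀ {x y} → directAdj G H x y → directAdj G H y x
  direct-sym {x} {y} x~y =
    let (g~g' , h~h') = cast (direct-view G H x y) x~y
    in cast (sym (direct-view G H y x)) (G.adj-sym g~g' , H.adj-sym h~h')

  factorise : ∀ x g h → 𝟙 (direct-adj? x (combine g h)) ≡ 𝟙 (G.adj? (π₁ x) g) * 𝟙 (H.adj? (π₂ x) h)
  factorise x g h = trans (cong (λ c → 𝟙 (G.adj? (π₁ x) (proj₁ c) ×-dec H.adj? (π₂ x) (proj₂ c)))
                                (Fin.remQuot-combine g h))
                          (𝟙-× (G.adj? (π₁ x) g) (H.adj? (π₂ x) h))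

  degree≤ : ∀ x → ∑[ y < p * q ] 𝟙 (direct-adj? x y) ≤ Δ * Δ'
  degree≤ x = begin
      ∑[ y < p * q ] 𝟙 (direct-adj? x y)
    ≡⟨ ∑-combine p q (λ y → 𝟙 (direct-adj? x y)) ⟩
      ∑[ g < p ] ∑[ h < q ] 𝟙 (direct-adj? x (combine g h))
    ≡⟨ sum-cong-≗ (λ g → sum-cong-≗ (factorise x g)) ⟩
      ∑[ g < p ] ∑[ h < q ] (𝟙 (G.adj? (π₁ x) g) * 𝟙 (H.adj? (π₂ x) h))
    ≡⟨ sum-cong-≗ (λ g → sym (*-distribˡ-sum (𝟙 (G.adj? (π₁ x) g)) (λ h → 𝟙 (H.adj? (π₂ x) h)))) ⟩
      ∑[ g < p ] (𝟙 (G.adj? (π₁ x) g) * ∑[ h < q ] 𝟙 (H.adj? (π₂ x) h))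
    ≤⟨ ∑-mono p (λ g → *-monoʳ-≤ (𝟙 (G.adj? (π₁ x) g)) (H.degree≤ (π₂ x))) ⟩
      ∑[ g < p ] (𝟙 (G.adj? (π₁ x) g) * Δ')
    ≡⟨ sum-cong-≗ (λ g → *-comm (𝟙 (G.adj? (π₁ x) g)) Δ') ⟩
      ∑[ g < p ] (Δ' * 𝟙 (G.adj? (π₁ x) g))
    ≡⟨ sym (*-distribˡ-sum Δ' (λ g → 𝟙 (G.adj? (π₁ x) g))) ⟩
      Δ' * ∑[ g < p ] 𝟙 (G.adj? (π₁ x) g)
    ≤⟨ *-monoʳ-≤ Δ' (G.degree≤ (π₁ x)) ⟩
      Δ' * Δ
    ≡⟨ *-comm Δ' Δ ⟩
      Δ * Δ'
    ∎
    where open ≤-Reasoning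

record TotalDominatingSet (G : Graph) (s : ℕ) : Set where
  field
    member    : Fin (order G) → ℕ
    member≤1  : ∀ v → member v ≤ 1
    dominates : ∀ v → ∃[ u ] (adj G v u × member u ≡ 1)
    size      : ∑[ v < order G ] member v ≡ s

module _ {G H : Graph} {a b : ℕ} (A : TotalDominatingSet G a) (B : TotalDominatingSet H b) where
  private
    module A = TotalDominatingSet A
    module B = TotalDominatingSet B
    p = order G
    q = order H
    π₁ : Fin (p * q) → Fin p
    π₁ = quotient {p} q
    π₂ : Fin (p * q) → Fin q
    π₂ = remainder {p} q

  product-trdf : Fin (p * q) → ℕ
  product-trdf x = 2 * (A.member (π₁ x) * B.member (π₂ x))

  private
    at-combine : ∀ g h → product-trdf (combine g h) ≡ 2 * (A.member g * B.member h)
    at-combine g h = cong (λ c → 2 * (A.member (proj₁ c) * B.member (proj₂ c))) (Fin.remQuot-combine g h)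

    sees-two : ∀ x → ∃[ y ] (directAdj G H x y × product-trdf y ≡ 2)
    sees-two x =
      let (g' , g~g' , g'∈A) = A.dominates (π₁ x)
          (h' , h~h' , h'∈B) = B.dominates (π₂ x)
          y = combine g' h'
      in y
       , cast (sym (direct-view G H x y))
              (subst (λ c → adj G (π₁ x) (proj₁ c) × adj H (π₂ x) (proj₂ c))
                     (sym (Fin.remQuot-combine g' h')) (g~g' , h~h'))
       , trans (at-combine g' h') (cong₂ (λ m n → 2 * (m * n)) g'∈A h'∈B)

  product-trdf-is-trdf : IsTRDF (Direct G H) product-trdf
  product-trdf-is-trdf =
      (λ x → *-monoʳ-≤ 2 (*-mono-≤ (A.member≤1 (π₁ x)) (B.member≤1 (π₂ x))))
    , (λ x _ → sees-two x)
    , (λ x _ → let (y , x~y , fy≡2) = sees-two x in y , x~y , λ fy≡0 → 2≢0 (trans (sym fy≡2) fy≡0))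
    where 2≢0 : ¬ (2 ≡ 0)
          2≢0 ()

  product-trdf-weight : weight (Direct G H) product-trdf ≡ 2 * (a * b)
  product-trdf-weight = begin
      weight (Direct G H) product-trdf
    ≡⟨ sumFin≡∑ (p * q) product-trdf ⟩
      ∑[ x < p * q ] product-trdf x
    ≡⟨ ∑-combine p q product-trdf ⟩
      ∑[ g < p ] ∑[ h < q ] product-trdf (combine g h)
    ≡⟨ sum-cong-≗ (λ g → sum-cong-≗ (at-combine g)) ⟩
      ∑[ g < p ] ∑[ h < q ] (2 * (A.member g * B.member h))
    ≡⟨ sum-cong-≗ (λ g → sym (*-distribˡ-sum 2 (λ h → A.member g * B.member h))) ⟩
      ∑[ g < p ] (2 * ∑[ h < q ] (A.member g * B.member h))
    ≡⟨ sym (*-distribˡ-sum 2 (λ g → ∑[ h < q ] (A.member g * B.member h))) ⟩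
      2 * ∑[ g < p ] ∑[ h < q ] (A.member g * B.member h)
    ≡⟨ cong (2 *_) (sum-cong-≗ (λ g → sym (*-distribˡ-sum (A.member g) B.member))) ⟩
      2 * ∑[ g < p ] (A.member g * ∑[ h < q ] B.member h)
    ≡⟨ cong (2 *_) (sym (*-distribʳ-sum (∑[ h < q ] B.member h) A.member)) ⟩
      2 * (∑[ g < p ] A.member g * ∑[ h < q ] B.member h)
    ≡⟨ cong₂ (λ m n → 2 * (m * n)) A.size B.size ⟩
      2 * (a * b)
    ∎
    where open ≡-Reasoning

direct-product-γtR : ∀ {G H Δ Δ' a b} → MaxDegree G Δ → MaxDegree H Δ' → 2 ≤ Δ * Δ' →
  TotalDominatingSet G a → Δ * a ≡ order G →
  TotalDominatingSet H b → Δ' * b ≡ order H →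
  TRDomNumberIs (Direct G H) (2 * (a * b))
direct-product-γtR {G} {H} {Δ} {Δ'} {a} {b} mdG mdH 2≤ΔΔ' A Δa≡|G| B Δ'b≡|H| =
  (product-trdf A B , product-trdf-is-trdf A B , product-trdf-weight A B) , lower
  where
  lower : ∀ f → IsTRDF (Direct G H) f → 2 * (a * b) ≤ weight (Direct G H) f
  lower f trdf = *-cancelˡ-≤ (Δ * Δ') {{>-nonZero (≤-trans (s≤s z≤n) 2≤ΔΔ')}} (begin
      Δ * Δ' * (2 * (a * b))      ≡⟨ regroup Δ Δ' a b ⟩
      2 * ((Δ * a) * (Δ' * b))    ≡⟨ cong₂ (λ m n → 2 * (m * n)) Δa≡|G| Δ'b≡|H| ⟩
      2 * (order G * order H)     ≤⟨ trdf-lower-bound (direct-degree mdG mdH) 2≤ΔΔ' f trdf ⟩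
      Δ * Δ' * weight (Direct G H) f ∎)
    where
    open ≤-Reasoning
    regroup : ∀ d d' m n → d * d' * (2 * (m * n)) ≡ 2 * ((d * m) * (d' * n))
    regroup = solve-∀

suc-mod : ∀ x K .{{_ : NonZero K}} → suc (x % K) < K → suc x % K ≡ suc (x % K)
suc-mod x K 1+x%K<K = begin
    suc x % K                        ≡⟨ cong (λ y → suc y % K) (m≡m%n+[m/n]*n x K) ⟩
    (suc (x % K) + (x / K) * K) % K  ≡⟨ [m+kn]%n≡m%n (suc (x % K)) (x / K) K ⟩
    suc (x % K) % K                  ≡⟨ m<n⇒m%n≡m 1+x%K<K ⟩
    suc (x % K)                      ∎
  where open ≡-Reasoning

residue<K : ∀ x K .{{_ : NonZero K}} {ρ} → x % K ≡ ρ → ρ < K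
residue<K x K refl = m%n<n x K

-- On a cycle whose length is a multiple of K, a vertex of residue ρ < K - 1 has
-- a neighbour (its successor, which does not wrap round) of residue ρ + 1.
cycle-step-up : ∀ {k} K .{{_ : NonZero K}} → K ∣ k → (i : Fin k) {ρ : ℕ} →
  toℕ i % K ≡ ρ → suc ρ < K → ∃[ j ] (cycleAdj k i j × toℕ j % K ≡ suc ρ)
cycle-step-up {k} K K∣k i refl 1+ρ<K with m≤n⇒m<n∨m≡n (Fin.toℕ<n i)
... | inj₁ 1+i<k = fromℕ< 1+i<k , inj₁ (Fin.toℕ-fromℕ< 1+i<k)
                 , trans (cong (_% K) (Fin.toℕ-fromℕ< 1+i<k)) (suc-mod (toℕ i) K 1+ρ<K)
... | inj₂ 1+i≡k = ⊥-elim (0≢1+n (trans (sym wraps) (suc-mod (toℕ i) K 1+ρ<K)))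
  where
  wraps : suc (toℕ i) % K ≡ 0
  wraps = n∣m⇒m%n≡0 (suc (toℕ i)) K (subst (K ∣_) (sym 1+i≡k) K∣k)

cycle-step-down : ∀ {k} K .{{_ : NonZero K}} (i : Fin k) {ρ : ℕ} →
  toℕ i % K ≡ suc ρ → ∃[ j ] (cycleAdj k i j × toℕ j % K ≡ ρ)
cycle-step-down {k} K i {ρ} i%K≡1+ρ with toℕ i | Fin.toℕ<n i
... | zero  | _ = ⊥-elim (0≢1+n (trans (sym (m<n⇒m%n≡m (>-nonZero⁻¹ K))) i%K≡1+ρ))
... | suc y | 1+y<k = fromℕ< y<k , inj₂ (inj₁ (cong suc (sym (Fin.toℕ-fromℕ< y<k))))
                    , trans (cong (_% K) (Fin.toℕ-fromℕ< y<k)) y%K≡ρ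
  where
  y<k : y < k
  y<k = <-trans (n<1+n y) 1+y<k
  y%K≡ρ : y % K ≡ ρ
  y%K≡ρ = ≤-antisym
    ([1+m%d]≤1+n⇒[m%d]≤n y ρ K (subst (0 <_) (sym i%K≡1+ρ) (s≤s z≤n)) (≤-reflexive i%K≡1+ρ))
    (m<[1+n%d]⇒m≤[n%d] y K (subst (ρ <_) (sym i%K≡1+ρ) (n<1+n ρ)))

into-pattern : ∀ {k K ρ} .{{_ : NonZero K}} (P : ℕ → ℕ) {i : Fin k} → P ρ ≡ 1 →
  ∃[ j ] (cycleAdj k i j × toℕ j % K ≡ ρ) → ∃[ j ] (cycleAdj k i j × P (toℕ j % K) ≡ 1)
into-pattern P Pρ≡1 (j , i~j , j%K≡ρ) = j , i~j , trans (cong P j%K≡ρ) Pρ≡1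

periodic-sum : ∀ K .{{_ : NonZero K}} q (P : ℕ → ℕ) →
  ∑[ i < q * K ] P (toℕ i % K) ≡ q * ∑[ ρ < K ] P (toℕ ρ)
periodic-sum K q P = begin
    ∑[ i < q * K ] P (toℕ i % K)
  ≡⟨ ∑-combine q K (λ i → P (toℕ i % K)) ⟩
    ∑[ a < q ] ∑[ ρ < K ] P (toℕ (combine a ρ) % K)
  ≡⟨ sum-cong-≗ (λ a → sum-cong-≗ (λ ρ → cong P (residue a ρ))) ⟩
    ∑[ a < q ] ∑[ ρ < K ] P (toℕ ρ)
  ≡⟨ ∑-const q (∑[ ρ < K ] P (toℕ ρ)) ⟩
    q * ∑[ ρ < K ] P (toℕ ρ)
  ∎
  where
  open ≡-Reasoning
  residue : ∀ (a : Fin q) (ρ : Fin K) → toℕ (combine a ρ) % K ≡ toℕ ρ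
  residue a ρ = begin
      toℕ (combine a ρ) % K    ≡⟨ cong (_% K) (Fin.toℕ-combine a ρ) ⟩
      (K * toℕ a + toℕ ρ) % K  ≡⟨ %-remove-+ˡ (toℕ ρ) (subst (K ∣_) (*-comm (toℕ a) K) (n∣m*n (toℕ a))) ⟩
      toℕ ρ % K                ≡⟨ m<n⇒m%n≡m (Fin.toℕ<n ρ) ⟩
      toℕ ρ                    ∎

-- In C_{4q} the vertices of residue 1 or 2 mod 4 form a total dominating set of
-- size 2q: residues 0, 1 are dominated by their successor, residues 2, 3 by
-- their predecessor.
cycle-pattern : ℕ → ℕ
cycle-pattern 1 = 1
cycle-pattern 2 = 1
cycle-pattern _ = 0

cycle-tds : ∀ q → TotalDominatingSet (Cycle (q * 4)) (q * 2)
cycle-tds q = record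
  { member    = λ i → cycle-pattern (toℕ i % 4)
  ; member≤1  = λ i → pattern≤1 (toℕ i % 4)
  ; dominates = dominates
  ; size      = periodic-sum 4 q cycle-pattern
  }
  where
  pattern≤1 : ∀ ρ → cycle-pattern ρ ≤ 1
  pattern≤1 0 = z≤n
  pattern≤1 1 = ≤-refl
  pattern≤1 2 = ≤-refl
  pattern≤1 (suc (suc (suc _))) = z≤n

  up : ∀ (i : Fin (q * 4)) {ρ} → toℕ i % 4 ≡ ρ → suc ρ < 4 → cycle-pattern (suc ρ) ≡ 1 →
    ∃[ j ] (cycleAdj (q * 4) i j × cycle-pattern (toℕ j % 4) ≡ 1)
  up i e lt p = into-pattern cycle-pattern p (cycle-step-up 4 (n∣m*n q) i e lt)

  down : ∀ (i : Fin (q * 4)) {ρ} → toℕ i % 4 ≡ suc ρ → cycle-pattern ρ ≡ 1 →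
    ∃[ j ] (cycleAdj (q * 4) i j × cycle-pattern (toℕ j % 4) ≡ 1)
  down i e p = into-pattern cycle-pattern p (cycle-step-down 4 i e)

  dominates : ∀ i → ∃[ j ] (cycleAdj (q * 4) i j × cycle-pattern (toℕ j % 4) ≡ 1)
  dominates i with toℕ i % 4 in e
  ... | 0 = up i e (s≤s (s≤s z≤n)) refl
  ... | 1 = up i e (s≤s (s≤s (s≤s z≤n))) refl
  ... | 2 = down i e refl
  ... | 3 = down i e refl
  ... | suc (suc (suc (suc _))) with residue<K (toℕ i) 4 e
  ...   | s≤s (s≤s (s≤s (s≤s ())))

ktt-tds : ∀ t → 0 < t → TotalDominatingSet (CompleteBipartite t) 2
ktt-tds (suc t') _ = record
  { member    = λ h → 𝟙 (chosen? h)
  ; member≤1  = λ h → 𝟙≤1 (chosen? h)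
  ; dominates = dominates
  ; size      = cong suc (trans (count-index (t' + t) t') (𝟙-yes (t' <? t' + t) (m<m+n t' (s≤s z≤n))))
  }
  where
  t = suc t'
  chosen? = λ (h : Fin (t + t)) → (toℕ h ≟ 0) ⊎-dec (toℕ h ≟ t)
  t<2t : t < t + t
  t<2t = m<m+n t (s≤s z≤n)
  0<2t : 0 < t + t
  0<2t = s≤s z≤n

  dominates : ∀ h → ∃[ h' ] (kttAdj t h h' × 𝟙 (chosen? h') ≡ 1)
  dominates h with toℕ h <? t
  ... | yes h<t = fromℕ< t<2t , inj₁ (h<t , ≤-reflexive (sym (Fin.toℕ-fromℕ< t<2t)))
                , 𝟙-yes (chosen? (fromℕ< t<2t)) (inj₂ (Fin.toℕ-fromℕ< t<2t))
  ... | no h≮t  = fromℕ< 0<2t , inj₂ (≮⇒≥ h≮t , s≤s z≤n) , refl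

-- In the prism over C_{3r} the vertices of residue 1 mod 3 in both copies form a
-- total dominating set of size 2r: residue 1 is dominated through the matching,
-- residues 0 and 2 by a cycle neighbour of residue 1 in the same copy.
prism-pattern : ℕ → ℕ
prism-pattern 1 = 1
prism-pattern _ = 0

prism-tds : ∀ r → TotalDominatingSet (Prism (Cycle (3 * r))) (r + r)
prism-tds r = record
  { member    = λ v → tagged-member (splitAt n v)
  ; member≤1  = λ v → pattern≤1 (toℕ (reduce (splitAt n v)) % 3)
  ; dominates = dominates
  ; size      = trans (∑-splitAt n n tagged-member) (cong₂ _+_ one-copy one-copy)
  }
  where
  n = 3 * r
  C = Cycle n

  tagged-member : Fin n ⊎ Fin n → ℕ
  tagged-member s = prism-pattern (toℕ (reduce s) % 3)

  pattern≤1 : ∀ ρ → prism-pattern ρ ≤ 1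
  pattern≤1 0 = z≤n
  pattern≤1 1 = ≤-refl
  pattern≤1 (suc (suc _)) = z≤n

  one-copy : ∑[ p < n ] prism-pattern (toℕ p % 3) ≡ r
  one-copy = trans (cong (λ k → ∑[ p < k ] prism-pattern (toℕ p % 3)) (*-comm 3 r))
                   (trans (periodic-sum 3 r prism-pattern) (*-identityʳ r))

  in-copy : ∀ p → toℕ p % 3 ≢ 1 → ∃[ j ] (cycleAdj n p j × prism-pattern (toℕ j % 3) ≡ 1)
  in-copy p ≢1 with toℕ p % 3 in e
  ... | 0 = into-pattern prism-pattern refl (cycle-step-up 3 (divides r (*-comm 3 r)) p e (s≤s (s≤s z≤n)))
  ... | 1 = ⊥-elim (≢1 refl)
  ... | 2 = into-pattern prism-pattern refl (cycle-step-down 3 p e)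
  ... | suc (suc (suc _)) with residue<K (toℕ p) 3 e
  ...   | s≤s (s≤s (s≤s ()))

  tagged-dominates : ∀ s → ∃[ s' ] (PrismAdj C s s' × tagged-member s' ≡ 1)
  tagged-dominates (inj₁ p) with toℕ p % 3 ≟ 1
  ... | yes e = inj₂ p , refl , cong prism-pattern e
  ... | no ≢1 = let (j , p~j , e) = in-copy p ≢1 in inj₁ j , p~j , e
  tagged-dominates (inj₂ p) with toℕ p % 3 ≟ 1
  ... | yes e = inj₁ p , refl , cong prism-pattern e
  ... | no ≢1 = let (j , p~j , e) = in-copy p ≢1 in inj₂ j , p~j , e

  dominates : ∀ v → ∃[ u ] (prismAdj C v u × tagged-member (splitAt n u) ≡ 1)
  dominates v =
    let (s' , v~s' , e) = tagged-dominates (splitAt n v)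
    in join n n s' , prism-adj-join C v s' v~s' , trans (cong tagged-member (Fin.splitAt-join n n s')) e

-- Each part is the main theorem for a pair of families; the remaining equations
-- are perfectness (Δ|A| = |V|) and the arithmetic identifying 2|A||B|.
corollary18 : (m n t r : ℕ) → 0 < m → 0 < n → 4 ∣ m → 4 ∣ n → 2 ≤ t → 1 ≤ r →
    TRDomNumberIs (Direct (Cycle m) (Cycle n)) ((m * n) / 2)
    × TRDomNumberIs (Direct (Cycle m) (CompleteBipartite t)) (2 * m)
    × TRDomNumberIs (Direct (Cycle m) (Prism (Cycle (3 * r)))) (2 * m * r)
    × TRDomNumberIs (Direct (CompleteBipartite t) (Prism (Cycle (3 * r)))) (8 * r)
corollary18 _ _ t r _ _ (divides q refl) (divides q' refl) 2≤t _ =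
    subst (TRDomNumberIs _) (value-i q q') (direct-product-γtR (cycle-degree _) (cycle-degree _)
      (s≤s (s≤s z≤n)) (cycle-tds q) (cycle-tight q) (cycle-tds q') (cycle-tight q'))
  , subst (TRDomNumberIs _) (value-ii q) (direct-product-γtR (cycle-degree _) (ktt-degree t)
      (*-monoʳ-≤ 2 0<t) (cycle-tds q) (cycle-tight q) (ktt-tds t 0<t) (ktt-tight t))
  , subst (TRDomNumberIs _) (value-iii q r) (direct-product-γtR (cycle-degree _) prism-C₃ᵣ
      (s≤s (s≤s z≤n)) (cycle-tds q) (cycle-tight q) (prism-tds r) (prism-tight r))
  , subst (TRDomNumberIs _) (value-iv r) (direct-product-γtR (ktt-degree t) prism-C₃ᵣ
      (≤-trans 2≤t (m≤m*n t 3)) (ktt-tds t 0<t) (ktt-tight t) (prism-tds r) (prism-tight r))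
  where
  prism-C₃ᵣ = prism-degree (cycle-degree (3 * r))
  0<t : 0 < t
  0<t = ≤-trans (s≤s z≤n) 2≤t
  cycle-tight : ∀ q → 2 * (q * 2) ≡ q * 4
  cycle-tight = solve-∀
  ktt-tight : ∀ t → t * 2 ≡ t + t
  ktt-tight = solve-∀
  prism-tight : ∀ r → 3 * (r + r) ≡ 3 * r + 3 * r
  prism-tight = solve-∀
  value-i : ∀ q q' → 2 * (q * 2 * (q' * 2)) ≡ (q * 4 * (q' * 4)) / 2
  value-i q q' = trans (sym (m*n/n≡m _ 2)) (cong (_/ 2) (regroup q q'))
    where regroup : ∀ a b → 2 * (a * 2 * (b * 2)) * 2 ≡ a * 4 * (b * 4)
          regroup = solve-∀
  value-ii : ∀ q → 2 * (q * 2 * 2) ≡ 2 * (q * 4)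
  value-ii = solve-∀
  value-iii : ∀ q r → 2 * (q * 2 * (r + r)) ≡ 2 * (q * 4) * r
  value-iii = solve-∀
  value-iv : ∀ r → 2 * (2 * (r + r)) ≡ 8 * r
  value-iv = solve-∀
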